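{- Let $G$ be a connected diamond-free CIS graph and suppose $G$ contains an induced subgraph $H$ with $H\cong L(K_{n,n})$ for some $n\ge 3$. Consider the $2n$ cliques of $H$ of size $n$ that correspond to the stars of the $2n$ vertices of $K_{n,n}$ (i.e., writing $V(H)=\{(i,j):1\le i,j\le n\}$ with $(i,j)(k,l)$ an edge iff exactly one of $i=k$, $j=l$ holds, these are the sets $R_i=\{(i,j):1\le j\le n\}$ and $L_j=\{(i,j):1\le i\le n\}$). Then either all of these $2n$ cliques are maximal cliques of $G$ or none of them is a maximal clique of $G$. Furthermore, if all $2n$ of them are maximal cliques of $G$, then $G=H$.
   Context: Graphs are finite and simple. The diamond is $K_4$ minus an edge; diamond-free means no induced diamond. A clique is strong if it intersects every inclusion-maximal stable set; $G$ is CIS if every inclusion-maximal clique of $G$ is strong. $L(K_{n,n})$ is the line graph of the complete bipartite graph $K_{n,n}$. -}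

module Defs where

open import Data.Nat using (ℕ; _≤_)
open import Data.Bool using (Bool; true; false)
open import Data.Fin using (Fin)
open import Data.Fin.Properties using (_≟_; any?)
open import Data.Fin.Subset using (Subset; _∈_; _∉_; _⊆_)
open import Data.Vec using (tabulate)
open import Data.Product using (Σ; ∃; ∃-syntax; _×_; _,_)
open import Data.Sum using (_⊎_)
open import Data.Empty using (⊥)
open import Relation.Nullary using (¬_)
open import Relation.Nullary.Decidable using (⌊_⌋)
open import Relation.Binary.PropositionalEquality using (_≡_; _≢_)

record Graph (m : ℕ) : Set where
  field
    adj   : Fin m → Fin m → Bool
    sym   : ∀ x y → adj x y ≡ adj y x
    irref : ∀ x → adj x x ≡ false
open Graph public

module _ {m : ℕ} (G : Graph m) where

  IsClique : Subset m → Set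
  IsClique C = ∀ x y → x ∈ C → y ∈ C → x ≢ y → adj G x y ≡ true

  IsStable : Subset m → Set
  IsStable S = ∀ x y → x ∈ S → y ∈ S → adj G x y ≡ false

  IsMaximalClique : Subset m → Set
  IsMaximalClique C = IsClique C × (∀ D → IsClique D → C ⊆ D → D ⊆ C)

  IsMaximalStable : Subset m → Set
  IsMaximalStable S = IsStable S × (∀ T → IsStable T → S ⊆ T → T ⊆ S)

  IsStrong : Subset m → Set
  IsStrong C = ∀ S → IsMaximalStable S → ∃[ v ] (v ∈ C × v ∈ S)

  IsCIS : Set
  IsCIS = ∀ C → IsMaximalClique C → IsStrong C

  DiamondFree : Set
  DiamondFree = ∀ a b c d → c ≢ d →
    adj G a b ≡ true → adj G a c ≡ true → adj G a d ≡ true →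
    adj G b c ≡ true → adj G b d ≡ true → adj G c d ≡ false → ⊥

  data Reach : Fin m → Fin m → Set where
    here : ∀ {x} → Reach x x
    step : ∀ {x y z} → adj G x y ≡ true → Reach y z → Reach x z

  Connected : Set
  Connected = ∀ x y → Reach x y

  -- f : Fin n × Fin n → V(G) is an isomorphism from L(K_{n,n}) onto an
  -- induced subgraph of G: injective, and (i,j)~(k,l) iff exactly one of i=k, j=l.
  IsInducedLKnn : (n : ℕ) → (Fin n → Fin n → Fin m) → Set
  IsInducedLKnn n f =
    (∀ i j k l → f i j ≡ f k l → (i ≡ k × j ≡ l)) ×
    (∀ i j k l → (adj G (f i j) (f k l) ≡ true →
                   ((i ≡ k × j ≢ l) ⊎ (i ≢ k × j ≡ l))) ×
                 (((i ≡ k × j ≢ l) ⊎ (i ≢ k × j ≡ l)) →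
                   adj G (f i j) (f k l) ≡ true))

rowSet : {m n : ℕ} → (Fin n → Fin n → Fin m) → Fin n → Subset m
rowSet f i = tabulate (λ v → ⌊ any? (λ j → v ≟ f i j) ⌋)

colSet : {m n : ℕ} → (Fin n → Fin n → Fin m) → Fin n → Subset m
colSet f j = tabulate (λ v → ⌊ any? (λ i → v ≟ f i j) ⌋)

-- Key step: let w be adjacent to f i j, and suppose its neighbours in H outside row i and column j
-- form a partial matching.  A permutation of the remaining (n-1) x (n-1) grid avoiding that matching
-- gives n-1 pairwise non-adjacent cells, none adjacent to w and one in each column other than j; with w
-- they form a stable set dominating R_i, so any maximal stable set containing it misses R_i.
-- A vertex complete to R_i is, by diamond-freeness, anticomplete to the rest of H, so the key step with
-- rows and columns exchanged shows that no L_j is strong, hence (CIS) none is maximal; since a clique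
-- of H is non-maximal exactly when some vertex is complete to it, this gives the dichotomy.  When all
-- R_i, L_j are maximal, two neighbours of an outside vertex in one row (column) would by
-- diamond-freeness make it complete to that row (column); so the key step rules out outside vertices
-- with a neighbour in H, and connectivity gives G = H.
module Submission where

open import Defs hiding (sym)
open import Data.Nat using (ℕ; zero; suc; _+_; _≤_; s≤s)
open import Data.Bool using (Bool; true; false)
import Data.Bool.Properties as Bool
open import Data.Fin using (Fin; zero; suc; punchIn; punchOut; opposite)
open import Data.Fin.Properties
  using (_≟_; any?; all?; punchIn-injective; punchInᵢ≢i; punchIn-punchOut; suc-injective; 0≢1+n;
         opposite-involutive)
open import Data.Fin.Subset using (Subset; _∈_; _∉_; _⊆_; _∪_; ⁅_⁆)
open import Data.Fin.Subset.Properties using (_∈?_; x∈⁅x⁆; x∈⁅y⁆⇒x≡y; x∈p∪q⁺; x∈p∪q⁻; q⊆p∪q)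
open import Data.Vec using (tabulate)
open import Data.Vec.Properties using (lookup∘tabulate; []=⇒lookup; lookup⇒[]=)
open import Data.List using (List; []; _∷_; allFin)
open import Data.List.Membership.Propositional using () renaming (_∈_ to _∈ₗ_)
open import Data.List.Membership.Propositional.Properties using (∈-allFin)
open import Data.List.Relation.Unary.Any using (here; there)
open import Data.Product using (∃-syntax; _×_; _,_; proj₁; proj₂)
import Data.Product as Product
open import Data.Sum using (_⊎_; inj₁; inj₂)
import Data.Sum as Sum
open import Function using (_∘_; flip)
open import Data.Empty using (⊥-elim)
open import Function.Definitions using (Injective)
open import Relation.Nullary using (¬_; ¬?; Dec; yes; no; contradiction)
open import Relation.Nullary.Decidable using (⌊_⌋; isYes≗does; dec-true; decidable-stable; _×-dec_; _→-dec_)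
open import Relation.Binary.PropositionalEquality using (_≡_; _≢_; refl; sym; trans; cong; subst)

image : ∀ {m n} → (Fin n → Fin m) → Subset m
image g = tabulate (λ v → ⌊ any? (λ t → v ≟ g t) ⌋)

∈-image⁺ : ∀ {m n} (g : Fin n → Fin m) t → g t ∈ image g
∈-image⁺ g t = lookup⇒[]= (g t) (image g)
  (trans (lookup∘tabulate _ (g t)) (trans (isYes≗does d) (dec-true d (t , refl))))
  where d = any? (λ s → g t ≟ g s)

∈-image⁻ : ∀ {m n} (g : Fin n → Fin m) {x} → x ∈ image g → ∃[ t ] x ≡ g t
∈-image⁻ g {x} x∈ = witness (any? (λ t → x ≟ g t)) (trans (sym (lookup∘tabulate _ x)) ([]=⇒lookup x∈))
  where
  witness : ∀ {A : Set} (d : Dec A) → ⌊ d ⌋ ≡ true → A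
  witness (yes a) _ = a

module _ {m : ℕ} (G : Graph m) where

  adj-sym : ∀ {x y} → adj G x y ≡ true → adj G y x ≡ true
  adj-sym {x} {y} = trans (Graph.sym G y x)

  HasNeighbourIn : Fin m → Subset m → Set
  HasNeighbourIn x S = ∃[ y ] (y ∈ S × adj G x y ≡ true)

  hasNeighbourIn? : ∀ x S → Dec (HasNeighbourIn x S)
  hasNeighbourIn? x S = any? (λ y → (y ∈? S) ×-dec (adj G x y Bool.≟ true))

  CompleteTo : Fin m → Subset m → Set
  CompleteTo v C = ∀ x → x ∈ C → adj G v x ≡ true

  completeTo? : ∀ v C → Dec (CompleteTo v C)
  completeTo? v C = all? (λ x → (x ∈? C) →-dec (adj G v x Bool.≟ true))

  Reach-invariant : (P : Fin m → Set) → (∀ {x y} → adj G x y ≡ true → P y → P x) →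
                    ∀ {x y} → Reach G x y → P y → P x
  Reach-invariant P closed here       py = py
  Reach-invariant P closed (step e r) py = closed e (Reach-invariant P closed r py)

  IsStable-⁅⁆∪ : ∀ {x S} → IsStable G S → ¬ HasNeighbourIn x S → IsStable G (⁅ x ⁆ ∪ S)
  IsStable-⁅⁆∪ {x} {S} stS free y z y∈ z∈ with x∈p∪q⁻ ⁅ x ⁆ S y∈ | x∈p∪q⁻ ⁅ x ⁆ S z∈
  ... | inj₁ y≡x | inj₁ z≡x rewrite x∈⁅y⁆⇒x≡y x y≡x | x∈⁅y⁆⇒x≡y x z≡x = irref G x
  ... | inj₁ y≡x | inj₂ z∈S rewrite x∈⁅y⁆⇒x≡y x y≡x = Bool.¬-not (λ xz → free (z , z∈S , xz))
  ... | inj₂ y∈S | inj₁ z≡x rewrite x∈⁅y⁆⇒x≡y x z≡x = Bool.¬-not (λ yx → free (y , y∈S , adj-sym yx))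
  ... | inj₂ y∈S | inj₂ z∈S = stS y z y∈S z∈S

  saturate : (xs : List (Fin m)) (S : Subset m) → IsStable G S →
             ∃[ T ] (IsStable G T × S ⊆ T × (∀ {x} → x ∈ₗ xs → x ∈ T ⊎ HasNeighbourIn x T))
  saturate [] S stS = S , stS , (λ x∈S → x∈S) , λ ()
  saturate (x ∷ xs) S stS with hasNeighbourIn? x S
  ... | yes (y , y∈S , xy) =
    let T , stT , S⊆T , covered = saturate xs S stS in
    T , stT , S⊆T , λ { (here refl) → inj₂ (y , S⊆T y∈S , xy) ; (there p) → covered p }
  ... | no free =
    let T , stT , S'⊆T , covered = saturate xs (⁅ x ⁆ ∪ S) (IsStable-⁅⁆∪ stS free) in
    T , stT , (λ y∈S → S'⊆T (q⊆p∪q ⁅ x ⁆ S y∈S)) ,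
    λ { (here refl) → inj₁ (S'⊆T (x∈p∪q⁺ (inj₁ (x∈⁅x⁆ x)))) ; (there p) → covered p }

  extendToMaximalStable : ∀ {S} → IsStable G S → ∃[ T ] (IsMaximalStable G T × S ⊆ T)
  extendToMaximalStable {S} stS with saturate (allFin m) S stS
  ... | T , stT , S⊆T , covered = T , (stT , maximal) , S⊆T
    where
    maximal : ∀ U → IsStable G U → T ⊆ U → U ⊆ T
    maximal U stU T⊆U {x} x∈U with covered (∈-allFin x)
    ... | inj₁ x∈T = x∈T
    ... | inj₂ (y , y∈T , xy) with trans (sym xy) (stU x y x∈U (T⊆U y∈T))
    ... | ()

  dominatingStable⇒¬IsStrong : ∀ {S C} → IsStable G S → (∀ {x} → x ∈ C → HasNeighbourIn x S) →
                               ¬ IsStrong G C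
  dominatingStable⇒¬IsStrong stS dominates strong with extendToMaximalStable stS
  ... | T , maxT , S⊆T with strong T maxT
  ... | x , x∈C , x∈T with dominates x∈C
  ... | y , y∈S , xy with trans (sym xy) (proj₁ maxT x y x∈T (S⊆T y∈S))
  ... | ()

  IsClique-⁅⁆∪ : ∀ {v C} → IsClique G C → CompleteTo v C → IsClique G (⁅ v ⁆ ∪ C)
  IsClique-⁅⁆∪ {v} {C} clC vC x y x∈ y∈ x≢y with x∈p∪q⁻ ⁅ v ⁆ C x∈ | x∈p∪q⁻ ⁅ v ⁆ C y∈
  ... | inj₁ x≡v | inj₁ y≡v = contradiction (trans (x∈⁅y⁆⇒x≡y v x≡v) (sym (x∈⁅y⁆⇒x≡y v y≡v))) x≢y
  ... | inj₁ x≡v | inj₂ y∈C rewrite x∈⁅y⁆⇒x≡y v x≡v = vC y y∈C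
  ... | inj₂ x∈C | inj₁ y≡v rewrite x∈⁅y⁆⇒x≡y v y≡v = adj-sym (vC x x∈C)
  ... | inj₂ x∈C | inj₂ y∈C = clC x y x∈C y∈C x≢y

  complete⇒¬IsMaximalClique : ∀ {v C} → v ∉ C → CompleteTo v C → ¬ IsMaximalClique G C
  complete⇒¬IsMaximalClique {v} {C} v∉C vC (clC , maxC) =
    v∉C (maxC (⁅ v ⁆ ∪ C) (IsClique-⁅⁆∪ clC vC) (q⊆p∪q ⁅ v ⁆ C) (x∈p∪q⁺ (inj₁ (x∈⁅x⁆ v))))

  IsMaximalClique⊎complete : ∀ {C} → IsClique G C → IsMaximalClique G C ⊎ ∃[ v ] (v ∉ C × CompleteTo v C)
  IsMaximalClique⊎complete {C} clC with any? (λ v → (¬? (v ∈? C)) ×-dec completeTo? v C)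
  ... | yes ext = inj₂ ext
  ... | no noExt = inj₁ (clC , maximal)
    where
    maximal : ∀ D → IsClique G D → C ⊆ D → D ⊆ C
    maximal D clD C⊆D {x} x∈D with x ∈? C
    ... | yes x∈C = x∈C
    ... | no x∉C = contradiction
      (x , x∉C , λ y y∈C → clD x y x∈D (C⊆D y∈C) (λ { refl → x∉C y∈C })) noExt

opposite-injective : ∀ {n} → Injective _≡_ _≡_ (opposite {n})
opposite-injective {_} {s} {t} e =
  trans (sym (opposite-involutive s)) (trans (cong opposite e) (opposite-involutive t))

PartialMatching : ∀ {n} → (Fin n → Fin n → Bool) → Set
PartialMatching F =
  (∀ {a b b'} → F a b ≡ true → F a b' ≡ true → b ≡ b') ×
  (∀ {a a' b} → F a b ≡ true → F a' b ≡ true → a ≡ a')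

-- Fails for n = 1: the single cell may be matched.
avoidingInjection : ∀ k (F : Fin (2 + k) → Fin (2 + k) → Bool) → PartialMatching F →
                    ∃[ h ] (Injective _≡_ _≡_ h × ∀ t → F (h t) t ≡ false)
avoidingInjection zero F (rowF , colF) with F zero zero in e₀₀ | F (suc zero) (suc zero) in e₁₁
... | false | false = (λ t → t) , (λ e → e) , λ { zero → e₀₀ ; (suc zero) → e₁₁ }
... | true  | _     = opposite , opposite-injective ,
  λ { zero → Bool.¬-not (λ e → 0≢1+n (sym (colF e e₀₀))) ; (suc zero) → Bool.¬-not (λ e → 0≢1+n (rowF e₀₀ e)) }
... | false | true  = opposite , opposite-injective ,
  λ { zero → Bool.¬-not (λ e → 0≢1+n (rowF e e₁₁)) ; (suc zero) → Bool.¬-not (λ e → 0≢1+n (colF e e₁₁)) }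
avoidingInjection (suc k) F (rowF , colF) = h , h-injective , h-avoids
  where
  free : ∃[ p ] F p zero ≡ false
  free with F zero zero in e₀ | F (suc zero) zero in e₁
  ... | false | _     = zero , e₀
  ... | true  | false = suc zero , e₁
  ... | true  | true  with colF e₀ e₁
  ... | ()
  p = proj₁ free
  F' : Fin (2 + k) → Fin (2 + k) → Bool
  F' a b = F (punchIn p a) (suc b)
  F'-matching : PartialMatching F'
  F'-matching = (λ e e' → suc-injective (rowF e e')) ,
                (λ e e' → punchIn-injective p _ _ (colF e e'))
  rest = avoidingInjection k F' F'-matching
  h : Fin (3 + k) → Fin (3 + k)
  h zero    = p
  h (suc t) = punchIn p (proj₁ rest t)
  h-injective : Injective _≡_ _≡_ h
  h-injective {zero}  {zero}  _ = refl
  h-injective {zero}  {suc t} e = contradiction (sym e) (punchInᵢ≢i p _)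
  h-injective {suc s} {zero}  e = contradiction e (punchInᵢ≢i p _)
  h-injective {suc s} {suc t} e = cong suc (proj₁ (proj₂ rest) (punchIn-injective p _ _ e))
  h-avoids : ∀ t → F (h t) t ≡ false
  h-avoids zero    = proj₂ free
  h-avoids (suc t) = proj₂ (proj₂ rest) t

noMatches⇒PartialMatching : ∀ {n} {F : Fin n → Fin n → Bool} → (∀ a b → F a b ≡ false) → PartialMatching F
noMatches⇒PartialMatching {F = F} none = (λ {a b} e _ → absurd (none a b) e) , (λ {a a' b} e _ → absurd (none a b) e)
  where
  absurd : ∀ {x : Bool} {A : Set} → x ≡ false → x ≡ true → A
  absurd refl ()

transpose-IsInducedLKnn : ∀ {m} {G : Graph m} {n} {f : Fin n → Fin n → Fin m} →
                          IsInducedLKnn G n f → IsInducedLKnn G n (flip f)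
transpose-IsInducedLKnn (injective , adjacency) =
  (λ i j k l e → Product.swap (injective j i l k e)) ,
  (λ i j k l → (λ e → exchange (proj₁ (adjacency j i l k) e)) , (λ p → proj₂ (adjacency j i l k) (exchange p)))
  where
  exchange : ∀ {A B C D : Set} → (A × B) ⊎ (C × D) → (D × C) ⊎ (B × A)
  exchange = Sum.swap ∘ Sum.map Product.swap Product.swap

module LineGraph {m : ℕ} (G : Graph m) (diamondFree : DiamondFree G) {k : ℕ}
                 (f : Fin (3 + k) → Fin (3 + k) → Fin m) (induced : IsInducedLKnn G (3 + k) f) where

  adjacent⇒ : ∀ {i j a b} → adj G (f i j) (f a b) ≡ true → (i ≡ a × j ≢ b) ⊎ (i ≢ a × j ≡ b)
  adjacent⇒ = proj₁ (proj₂ induced _ _ _ _)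

  row-adjacent : ∀ i {b b'} → b ≢ b' → adj G (f i b) (f i b') ≡ true
  row-adjacent i b≢b' = proj₂ (proj₂ induced _ _ _ _) (inj₁ (refl , b≢b'))

  col-adjacent : ∀ {i i'} b → i ≢ i' → adj G (f i b) (f i' b) ≡ true
  col-adjacent b i≢i' = proj₂ (proj₂ induced _ _ _ _) (inj₂ (i≢i' , refl))

  skew-nonadjacent : ∀ {i j a b} → i ≢ a → j ≢ b → adj G (f i j) (f a b) ≡ false
  skew-nonadjacent i≢a j≢b =
    Bool.¬-not (λ e → Sum.[ (λ (i≡a , _) → i≢a i≡a) , (λ (_ , j≡b) → j≢b j≡b) ] (adjacent⇒ e))

  InH : Fin m → Set
  InH w = ∃[ a ] ∃[ b ] w ≡ f a b

  inH? : ∀ w → Dec (InH w)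
  inH? w = any? (λ a → any? (λ b → w ≟ f a b))

  rowSet-IsClique : ∀ i → IsClique G (rowSet f i)
  rowSet-IsClique i x y x∈ y∈ x≢y with ∈-image⁻ (f i) x∈ | ∈-image⁻ (f i) y∈
  ... | b , refl | b' , refl = row-adjacent i (λ b≡b' → x≢y (cong (f i) b≡b'))

  completeTo-row : ∀ {v i} → CompleteTo G v (rowSet f i) → ∀ b → adj G v (f i b) ≡ true
  completeTo-row {i = i} vR b = vR _ (∈-image⁺ (f i) b)

  other : Fin (3 + k) → Fin (3 + k)
  other b = punchIn b zero

  other≢ : ∀ b → b ≢ other b
  other≢ b e = punchInᵢ≢i b zero (sym e)

  complete⇒offRow-nonadjacent : ∀ {v i a b} → CompleteTo G v (rowSet f i) → a ≢ i → adj G v (f a b) ≡ false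
  complete⇒offRow-nonadjacent {v} {i} {a} {b} vR a≢i = Bool.¬-not (λ vab →
    diamondFree v (f i b) (f i (other b)) (f a b)
      (λ e → a≢i (sym (proj₁ (proj₁ induced _ _ _ _ e))))
      (completeTo-row vR b) (completeTo-row vR (other b)) vab
      (row-adjacent i (other≢ b)) (col-adjacent b (a≢i ∘ sym))
      (skew-nonadjacent (a≢i ∘ sym) (other≢ b ∘ sym)))

  twoNeighbours⇒¬IsMaximalClique : ∀ {w a b b'} → ¬ InH w → b ≢ b' →
    adj G w (f a b) ≡ true → adj G w (f a b') ≡ true → ¬ IsMaximalClique G (rowSet f a)
  twoNeighbours⇒¬IsMaximalClique {w} {a} {b} {b'} w∉H b≢b' wb wb' =
    complete⇒¬IsMaximalClique G (λ w∈ → w∉H (a , ∈-image⁻ (f a) w∈)) complete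
    where
    adjacent : ∀ c → adj G w (f a c) ≡ true
    adjacent c with c ≟ b | c ≟ b'
    ... | yes refl | _        = wb
    ... | no _     | yes refl = wb'
    ... | no c≢b   | no c≢b'  = Bool.¬-not (λ wc →
      diamondFree (f a b) (f a b') w (f a c) (λ e → w∉H (a , c , e))
        (row-adjacent a b≢b') (adj-sym G wb) (row-adjacent a (c≢b ∘ sym))
        (adj-sym G wb') (row-adjacent a (c≢b' ∘ sym)) wc)
    complete : CompleteTo G w (rowSet f a)
    complete x x∈ with ∈-image⁻ (f a) x∈
    ... | c , refl = adjacent c

  partialMatching⇒¬IsStrong : ∀ {w i j} → adj G w (f i j) ≡ true →
    PartialMatching (λ a b → adj G w (f (punchIn i a) (punchIn j b))) → ¬ IsStrong G (rowSet f i)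
  partialMatching⇒¬IsStrong {w} {i} {j} wij matching =
    dominatingStable⇒¬IsStrong G (IsStable-⁅⁆∪ G cells-stable w-free) dominates
    where
    avoiding = avoidingInjection k _ matching
    h = proj₁ avoiding
    cell : Fin (2 + k) → Fin m
    cell t = f (punchIn i (h t)) (punchIn j t)
    cells-stable : IsStable G (image cell)
    cells-stable x y x∈ y∈ with ∈-image⁻ cell x∈ | ∈-image⁻ cell y∈
    ... | s , refl | t , refl with s ≟ t
    ... | yes refl = irref G (cell s)
    ... | no s≢t = skew-nonadjacent (s≢t ∘ proj₁ (proj₂ avoiding) ∘ punchIn-injective i _ _)
                                    (s≢t ∘ punchIn-injective j _ _)
    w-free : ¬ HasNeighbourIn G w (image cell)
    w-free (y , y∈ , wy) with ∈-image⁻ cell y∈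
    ... | t , refl with trans (sym wy) (proj₂ (proj₂ avoiding) t)
    ... | ()
    dominates : ∀ {x} → x ∈ rowSet f i → HasNeighbourIn G x (⁅ w ⁆ ∪ image cell)
    dominates x∈ with ∈-image⁻ (f i) x∈
    ... | b , refl with j ≟ b
    ... | yes refl = w , x∈p∪q⁺ (inj₁ (x∈⁅x⁆ w)) , adj-sym G wij
    ... | no j≢b = cell t , x∈p∪q⁺ (inj₂ (∈-image⁺ cell t)) ,
      subst (λ c → adj G (f i b) (f (punchIn i (h t)) c) ≡ true) (sym (punchIn-punchOut j≢b))
            (col-adjacent b (punchInᵢ≢i i (h t) ∘ sym))
      where
      t = punchOut j≢b

module RowsAndColumns {m : ℕ} (G : Graph m) (diamondFree : DiamondFree G) (cis : IsCIS G) {k : ℕ}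
                      (f : Fin (3 + k) → Fin (3 + k) → Fin m) (induced : IsInducedLKnn G (3 + k) f) where

  open LineGraph G diamondFree f induced public
  private
    module C = LineGraph G diamondFree (flip f) (transpose-IsInducedLKnn {G = G} induced)

  row-maximal⊎complete : ∀ i → IsMaximalClique G (rowSet f i) ⊎ ∃[ v ] CompleteTo G v (rowSet f i)
  row-maximal⊎complete i = Sum.map₂ (Product.map₂ proj₂) (IsMaximalClique⊎complete G (rowSet-IsClique i))

  complete-row⇒¬IsMaximalClique-col : ∀ {v i} → CompleteTo G v (rowSet f i) →
                                      ∀ j → ¬ IsMaximalClique G (colSet f j)
  complete-row⇒¬IsMaximalClique-col {v} {i} vR j maxL =
    C.partialMatching⇒¬IsStrong (completeTo-row vR j)
      (noMatches⇒PartialMatching (λ a b → complete⇒offRow-nonadjacent vR (punchInᵢ≢i i b)))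
      (cis _ maxL)

  allMaximal⇒closed : (∀ i → IsMaximalClique G (rowSet f i)) → (∀ j → IsMaximalClique G (colSet f j)) →
                      ∀ {x y} → adj G x y ≡ true → InH y → InH x
  allMaximal⇒closed rowsMax colsMax {x} xy (i , j , refl) with inH? x
  ... | yes x∈H = x∈H
  ... | no x∉H = ⊥-elim (partialMatching⇒¬IsStrong xy (sameCol , sameRow) (cis _ (rowsMax i)))
    where
    sameCol : ∀ {a b b'} → adj G x (f (punchIn i a) (punchIn j b)) ≡ true →
              adj G x (f (punchIn i a) (punchIn j b')) ≡ true → b ≡ b'
    sameCol {a} {b} {b'} e e' = decidable-stable (b ≟ b') (λ b≢b' →
      twoNeighbours⇒¬IsMaximalClique x∉H (b≢b' ∘ punchIn-injective j _ _) e e' (rowsMax (punchIn i a)))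
    sameRow : ∀ {a a' b} → adj G x (f (punchIn i a) (punchIn j b)) ≡ true →
              adj G x (f (punchIn i a') (punchIn j b)) ≡ true → a ≡ a'
    sameRow {a} {a'} {b} e e' = decidable-stable (a ≟ a') (λ a≢a' →
      C.twoNeighbours⇒¬IsMaximalClique (λ (c , d , x≡) → x∉H (d , c , x≡))
        (a≢a' ∘ punchIn-injective i _ _) e e' (colsMax (punchIn j b)))

module _ {m : ℕ} (G : Graph m) (diamondFree : DiamondFree G) (cis : IsCIS G) {k : ℕ}
         (f : Fin (3 + k) → Fin (3 + k) → Fin m) (induced : IsInducedLKnn G (3 + k) f) where

  private
    module R = RowsAndColumns G diamondFree cis f induced
    module C = RowsAndColumns G diamondFree cis (flip f) (transpose-IsInducedLKnn {G = G} induced)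

  maximalRowsCols-dichotomy :
    ((∀ i → IsMaximalClique G (rowSet f i)) × (∀ j → IsMaximalClique G (colSet f j)))
    ⊎ ((∀ i → ¬ IsMaximalClique G (rowSet f i)) × (∀ j → ¬ IsMaximalClique G (colSet f j)))
  maximalRowsCols-dichotomy with R.row-maximal⊎complete zero
  ... | inj₂ (v , vR) = inj₂ (rowsNot , colsNot)
    where
    colsNot : ∀ j → ¬ IsMaximalClique G (colSet f j)
    colsNot = R.complete-row⇒¬IsMaximalClique-col vR
    rowsNot : ∀ i → ¬ IsMaximalClique G (rowSet f i)
    rowsNot with C.row-maximal⊎complete zero
    ... | inj₁ col₀ = contradiction col₀ (colsNot zero)
    ... | inj₂ (u , uC) = C.complete-row⇒¬IsMaximalClique-col uC
  ... | inj₁ row₀ = inj₁ (rowsMax , colsMax)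
    where
    colsMax : ∀ j → IsMaximalClique G (colSet f j)
    colsMax j with C.row-maximal⊎complete j
    ... | inj₁ colⱼ = colⱼ
    ... | inj₂ (u , uC) = contradiction row₀ (C.complete-row⇒¬IsMaximalClique-col uC zero)
    rowsMax : ∀ i → IsMaximalClique G (rowSet f i)
    rowsMax i with R.row-maximal⊎complete i
    ... | inj₁ rowᵢ = rowᵢ
    ... | inj₂ (v , vR) = contradiction (colsMax zero) (R.complete-row⇒¬IsMaximalClique-col vR zero)

lemma6 : (m : ℕ) (G : Graph m) → Connected G → DiamondFree G → IsCIS G →
         (n : ℕ) → 3 ≤ n → (f : Fin n → Fin n → Fin m) → IsInducedLKnn G n f →
         (((∀ i → IsMaximalClique G (rowSet f i)) × (∀ j → IsMaximalClique G (colSet f j)))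
           ⊎ ((∀ i → ¬ IsMaximalClique G (rowSet f i)) × (∀ j → ¬ IsMaximalClique G (colSet f j))))
         × (((∀ i → IsMaximalClique G (rowSet f i)) × (∀ j → IsMaximalClique G (colSet f j)))
             → ∀ v → ∃[ i ] ∃[ j ] (v ≡ f i j))
lemma6 m G connected diamondFree cis .(3 + k) (s≤s (s≤s (s≤s {n = k} _))) f induced =
  maximalRowsCols-dichotomy G diamondFree cis f induced ,
  λ (rowsMax , colsMax) v →
    Reach-invariant G InH (allMaximal⇒closed rowsMax colsMax) (connected v (f zero zero)) (zero , zero , refl)
  where
  open RowsAndColumns G diamondFree cis f induced
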